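{- Let $n\ge2$. If $p\in S_m$ contains the pattern $321$, then there are infinitely many $\omega\in\widetilde{S}_n$ that avoid $p$.
   Context: For $n\ge1$, the affine symmetric group $\widetilde{S}_n$ is the set of all bijections $\omega:\mathbb{Z}\to\mathbb{Z}$ with $\omega(i+n)=\omega(i)+n$ for all $i\in\mathbb{Z}$ and $\sum_{i=1}^n\omega(i)=\binom{n+1}{2}$; write $\omega_i=\omega(i)$. For $p\in S_k$, $\omega$ contains $p$ if there are integers $i_1<\cdots<i_k$ such that $\omega_{i_1}\cdots\omega_{i_k}$ has the same relative order as $p_1\cdots p_k$; otherwise $\omega$ avoids $p$. A permutation $p$ contains $321$ if there exist $a<b<c$ with $p_a>p_b>p_c$. -}

module Defs where

open import Data.Nat as ℕ using (ℕ; zero; suc)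
open import Data.Nat.Combinatorics using (_C_)
open import Data.Integer as ℤ using (ℤ; +_)
open import Data.Fin as Fin using (Fin)
open import Data.Fin.Permutation using (Permutation′; _⟨$⟩ʳ_)
open import Data.Product using (Σ; ∃; ∃-syntax; _×_)
open import Function.Definitions using (Bijective)
open import Relation.Binary.PropositionalEquality using (_≡_)
open import Relation.Nullary using (¬_)
open import Function.Bundles using (_⇔_)

sumTo : ℕ → (ℤ → ℤ) → ℤ
sumTo zero    f = + 0
sumTo (suc k) f = sumTo k f ℤ.+ f (+ suc k)

record AffinePerm (n : ℕ) : Set where
  field
    ω        : ℤ → ℤ
    bijective : Bijective _≡_ _≡_ ω
    periodic  : ∀ i → ω (i ℤ.+ + n) ≡ ω i ℤ.+ + n
    windowSum : sumTo n ω ≡ + (suc n C 2)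
open AffinePerm public

Contains : ∀ {n k} → AffinePerm n → Permutation′ k → Set
Contains {n} {k} w p =
  Σ (Fin k → ℤ) λ i → ((∀ (a b : Fin k) → a Fin.< b → i a ℤ.< i b)
        × (∀ (a b : Fin k) → (ω w (i a) ℤ.< ω w (i b)) ⇔ ((p ⟨$⟩ʳ a) Fin.< (p ⟨$⟩ʳ b))))

Avoids : ∀ {n k} → AffinePerm n → Permutation′ k → Set
Avoids w p = ¬ Contains w p

Contains321 : ∀ {m} → Permutation′ m → Set
Contains321 {m} p =
  ∃[ a ] ∃[ b ] ∃[ c ] (a Fin.< b × b Fin.< c
    × (p ⟨$⟩ʳ b) Fin.< (p ⟨$⟩ʳ a) × (p ⟨$⟩ʳ c) Fin.< (p ⟨$⟩ʳ b))

_≈ᴬ_ : ∀ {n} → AffinePerm n → AffinePerm n → Set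
w ≈ᴬ v = ∀ x → ω w x ≡ ω v x

InfinitelyMany : ∀ {n} → (AffinePerm n → Set) → Set
InfinitelyMany {n} P =
  Σ (ℕ → AffinePerm n) λ f →
    (∀ i j → f i ≈ᴬ f j → i ≡ j) × (∀ i → P (f i))

module Submission where

open import Defs
open import Data.Nat using (ℕ; _≤_)
open import Data.Fin.Permutation using (Permutation′)

-- Idea (following the paper): an affine permutation whose values split
-- into two increasing subsequences cannot contain 321, hence avoids every
-- pattern p that contains 321.  For n = k + 1 and any multiple s of n let
--
--   σₛ(i) = i + k·s   if n ∣ i,        σₛ(i) = i − s   otherwise.
--
-- The shift ("jump") depends only on whether n ∣ i and is itself a multiple
-- of n, so σₛ maps each of the two classes {n ∣ i}, {n ∤ i} to itself by a
-- translation.  This makes σₛ a bijection that commutes with i ↦ i + n,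
-- increasing on both classes; in the window 1..n the jumps are k times −s
-- and once k·s, so the window sum is that of the identity.  For n ≥ 2 the
-- value σₛ(1) = 1 − s determines s, so s = t·n (t ∈ ℕ) gives infinitely
-- many distinct affine permutations, all avoiding p.

open import Data.Nat as N using (suc; zero; s≤s; z≤n)
import Data.Nat.Properties as NP
open import Data.Nat.Divisibility using (>⇒∤)
open import Data.Nat.Combinatorics using (_C_; nC1≡n; nCk+nC[k+1]≡[n+1]C[k+1])
open import Data.Integer using (ℤ; +_; _+_; _-_; _*_; -_; _<_)
import Data.Integer.Properties as ZP
open import Data.Integer.Divisibility.Signed
  using (_∣_; _∣?_; ∣⇒∣ᵤ; ∣-refl; ∣m∣n⇒∣m+n; ∣m+n∣n⇒∣m; ∣m⇒∣-m; ∣n⇒∣m*n; ∣m⇒∣m*n)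
open import Data.Integer.Solver using (module +-*-Solver)
open import Algebra.Properties.AbelianGroup ZP.+-0-abelianGroup using (∙-cancelʳ; ∙-cancelˡ)
open import Data.Product using (_,_; _×_; ∃-syntax)
open import Data.Empty using (⊥; ⊥-elim)
open import Function using (_∘_)
open import Level using (0ℓ)
open import Function.Bundles using (Equivalence)
open import Function.Consequences.Propositional using (strictlySurjective⇒surjective)
open import Relation.Nullary using (¬_; Dec; yes; no)
open import Relation.Unary using (Pred; Decidable)
open import Relation.Binary.PropositionalEquality using (_≡_; refl; sym; trans; cong; cong₂; subst; module ≡-Reasoning)

open +-*-Solver using (solve; _:=_; _:+_; _:-_; _:*_; :-_; con)

Occurs321 : (ℤ → ℤ) → Set
Occurs321 f = ∃[ x ] ∃[ y ] ∃[ z ] (x < y × y < z × f y < f x × f z < f y)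

contains⇒occurs321 : ∀ {n m} {w : AffinePerm n} {p : Permutation′ m} →
                     Contains321 p → Contains w p → Occurs321 (ω w)
contains⇒occurs321 (a , b , c , a<b , b<c , pb<pa , pc<pb) (i , increasing , orderIso) =
  i a , i b , i c , increasing a b a<b , increasing b c b<c ,
  Equivalence.from (orderIso b a) pb<pa , Equivalence.from (orderIso c b) pc<pb

IncreasingOn : Pred ℤ 0ℓ → (ℤ → ℤ) → Set
IncreasingOn P f = ∀ {x y} → P x → P y → x < y → f x < f y

-- Pigeonhole: two of the three positions of a 321 lie in the same class,
-- where f would have to both increase and decrease.
twoIncreasingClasses⇒no321 : ∀ {P : Pred ℤ 0ℓ} {f : ℤ → ℤ} → Decidable P →
  IncreasingOn P f → IncreasingOn (¬_ ∘ P) f → ¬ Occurs321 f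
twoIncreasingClasses⇒no321 {P} {f} P? incIn incOut (x , y , z , x<y , y<z , fy<fx , fz<fy) =
  classify (P? x) (P? y) (P? z)
  where
  x<z : x < z
  x<z = ZP.<-trans x<y y<z
  fz<fx : f z < f x
  fz<fx = ZP.<-trans fz<fy fy<fx
  classify : Dec (P x) → Dec (P y) → Dec (P z) → ⊥
  classify (yes px) (yes py) _        = ZP.<-asym fy<fx (incIn px py x<y)
  classify (no px)  (no py)  _        = ZP.<-asym fy<fx (incOut px py x<y)
  classify _        (yes py) (yes pz) = ZP.<-asym fz<fy (incIn py pz y<z)
  classify _        (no py)  (no pz)  = ZP.<-asym fz<fy (incOut py pz y<z)
  classify (yes px) (no _)   (yes pz) = ZP.<-asym fz<fx (incIn px pz x<z)
  classify (no px)  (yes _)  (no pz)  = ZP.<-asym fz<fx (incOut px pz x<z)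

sumTo-identity : ∀ j → sumTo j (λ i → i) ≡ + (suc j C 2)
sumTo-identity zero    = refl
sumTo-identity (suc j) = begin
  sumTo j (λ i → i) + + suc j  ≡⟨ cong (_+ + suc j) (sumTo-identity j) ⟩
  + (suc j C 2 N.+ suc j)      ≡⟨ cong (λ c → + (suc j C 2 N.+ c)) (sym (nC1≡n (suc j))) ⟩
  + (suc j C 2 N.+ suc j C 1)  ≡⟨ cong +_ (NP.+-comm (suc j C 2) (suc j C 1)) ⟩
  + (suc j C 1 N.+ suc j C 2)  ≡⟨ cong +_ (nCk+nC[k+1]≡[n+1]C[k+1] (suc j) 1) ⟩
  + (suc (suc j) C 2)          ∎
  where open ≡-Reasoning

sumTo-+ : ∀ j (f g : ℤ → ℤ) → sumTo j (λ i → f i + g i) ≡ sumTo j f + sumTo j g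
sumTo-+ zero    f g = refl
sumTo-+ (suc j) f g = begin
  sumTo j (λ i → f i + g i) + (f (+ suc j) + g (+ suc j))
    ≡⟨ cong (_+ (f (+ suc j) + g (+ suc j))) (sumTo-+ j f g) ⟩
  (sumTo j f + sumTo j g) + (f (+ suc j) + g (+ suc j))
    ≡⟨ interchange (sumTo j f) (sumTo j g) (f (+ suc j)) (g (+ suc j)) ⟩
  (sumTo j f + f (+ suc j)) + (sumTo j g + g (+ suc j)) ∎
  where
  open ≡-Reasoning
  interchange : ∀ a b c d → (a + b) + (c + d) ≡ (a + c) + (b + d)
  interchange = solve 4 (λ a b c d → (a :+ b) :+ (c :+ d) := (a :+ c) :+ (b :+ d)) refl

sumTo-constant : ∀ j (g : ℤ → ℤ) c → (∀ i → i N.< j → g (+ suc i) ≡ c) → sumTo j g ≡ + j * c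
sumTo-constant zero    g c _        = sym (ZP.*-zeroˡ c)
sumTo-constant (suc j) g c constant = begin
  sumTo j g + g (+ suc j)  ≡⟨ cong₂ _+_ (sumTo-constant j g c (λ i i<j → constant i (NP.m<n⇒m<1+n i<j)))
                                        (constant j NP.≤-refl) ⟩
  + j * c + c              ≡⟨ solve 2 (λ j c → j :* c :+ c := (con (+ 1) :+ j) :* c) refl (+ j) c ⟩
  + suc j * c              ∎
  where open ≡-Reasoning

not-multiple : ∀ {k} i → i N.< k → ¬ (+ suc k ∣ + suc i)
not-multiple i i<k = >⇒∤ (s≤s i<k) ∘ ∣⇒∣ᵤ

module TwoClassShift (k : ℕ) (s : ℤ) (n∣s : + suc k ∣ s) where

  n : ℤ
  n = + suc k

  jumpOf : ∀ {A : Set} → Dec A → ℤ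
  jumpOf (yes _) = s * + k
  jumpOf (no _)  = - s

  jump : ℤ → ℤ
  jump i = jumpOf (n ∣? i)

  σ : ℤ → ℤ
  σ i = i + jump i

  jump-multiple : ∀ {i} → n ∣ i → jump i ≡ s * + k
  jump-multiple {i} n∣i with n ∣? i
  ... | yes _   = refl
  ... | no  n∤i = ⊥-elim (n∤i n∣i)

  jump-other : ∀ {i} → ¬ n ∣ i → jump i ≡ - s
  jump-other {i} n∤i with n ∣? i
  ... | yes n∣i = ⊥-elim (n∤i n∣i)
  ... | no  _   = refl

  n∣jump : ∀ i → n ∣ jump i
  n∣jump i with n ∣? i
  ... | yes _ = ∣m⇒∣m*n (+ k) n∣s
  ... | no  _ = ∣m⇒∣-m n∣s

  jump-translate : ∀ x {a} → n ∣ a → jump (x + a) ≡ jump x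
  jump-translate x n∣a with n ∣? x
  ... | yes n∣x = jump-multiple (∣m∣n⇒∣m+n n∣x n∣a)
  ... | no  n∤x = jump-other (λ n∣x+a → n∤x (∣m+n∣n⇒∣m n∣x+a n∣a))

  jump-σ : ∀ x → jump (σ x) ≡ jump x
  jump-σ x = jump-translate x (n∣jump x)

  σ-injective : ∀ {x y} → σ x ≡ σ y → x ≡ y
  σ-injective {x} {y} σx≡σy = ∙-cancelʳ (jump x) x y (trans σx≡σy (cong (_+_ y) (sym sameJump)))
    where
    sameJump : jump x ≡ jump y
    sameJump = trans (sym (jump-σ x)) (trans (cong jump σx≡σy) (jump-σ y))

  -- The preimage of y is y − jump y, which lies in the class of y.
  σ-surjective : ∀ y → ∃[ x ] σ x ≡ y
  σ-surjective y = y - jump y , (begin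
    (y - jump y) + jump (y - jump y) ≡⟨ cong (_+_ (y - jump y)) (jump-translate y (∣m⇒∣-m (n∣jump y))) ⟩
    (y - jump y) + jump y             ≡⟨ solve 2 (λ y j → (y :- j) :+ j := y) refl y (jump y) ⟩
    y                                 ∎)
    where open ≡-Reasoning

  σ-periodic : ∀ i → σ (i + n) ≡ σ i + n
  σ-periodic i = begin
    (i + n) + jump (i + n) ≡⟨ cong (_+_ (i + n)) (jump-translate i ∣-refl) ⟩
    (i + n) + jump i       ≡⟨ solve 3 (λ i n j → (i :+ n) :+ j := (i :+ j) :+ n) refl i n (jump i) ⟩
    (i + jump i) + n       ∎
    where open ≡-Reasoning

  -- Within one class σ is a translation, hence increasing.
  σ-increasing : ∀ {x y} → jump x ≡ jump y → x < y → σ x < σ y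
  σ-increasing {x} {y} sameJump x<y =
    subst (σ x <_) (cong (_+_ y) sameJump) (ZP.+-monoˡ-< (jump x) x<y)

  increasing-multiples : IncreasingOn (n ∣_) σ
  increasing-multiples n∣x n∣y = σ-increasing (trans (jump-multiple n∣x) (sym (jump-multiple n∣y)))

  increasing-others : IncreasingOn (¬_ ∘ (n ∣_)) σ
  increasing-others n∤x n∤y = σ-increasing (trans (jump-other n∤x) (sym (jump-other n∤y)))

  -- Over the window 1..n the jumps cancel: k times −s, then k·s at n.
  sumTo-jump : sumTo (suc k) jump ≡ + 0
  sumTo-jump = begin
    sumTo k jump + jump n ≡⟨ cong₂ _+_ (sumTo-constant k jump (- s) (λ i i<k → jump-other (not-multiple i i<k)))
                                    (jump-multiple ∣-refl) ⟩
    + k * - s + s * + k   ≡⟨ solve 2 (λ k s → k :* (:- s) :+ s :* k := con (+ 0)) refl (+ k) s ⟩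
    + 0                   ∎
    where open ≡-Reasoning

  σ-windowSum : sumTo (suc k) σ ≡ + (suc (suc k) C 2)
  σ-windowSum = begin
    sumTo (suc k) σ                              ≡⟨ sumTo-+ (suc k) (λ i → i) jump ⟩
    sumTo (suc k) (λ i → i) + sumTo (suc k) jump ≡⟨ cong (_+_ (sumTo (suc k) (λ i → i))) sumTo-jump ⟩
    sumTo (suc k) (λ i → i) + + 0                ≡⟨ ZP.+-identityʳ _ ⟩
    sumTo (suc k) (λ i → i)                      ≡⟨ sumTo-identity (suc k) ⟩
    + (suc (suc k) C 2)                          ∎
    where open ≡-Reasoning

  affine : AffinePerm (suc k)
  affine = record
    { ω         = σ
    ; bijective = σ-injective , strictlySurjective⇒surjective σ-surjective
    ; periodic  = σ-periodic
    ; windowSum = σ-windowSum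
    }

  avoids-321-patterns : ∀ {m} (p : Permutation′ m) → Contains321 p → Avoids affine p
  avoids-321-patterns p p∋321 σ∋p =
    twoIncreasingClasses⇒no321 (n ∣?_) increasing-multiples increasing-others
      (contains⇒occurs321 {w = affine} {p} p∋321 σ∋p)

  -- For n ≥ 2, 1 is not a multiple of n, so σ(1) = 1 − s recovers s.
  jump-one : 1 ≤ k → jump (+ 1) ≡ - s
  jump-one 1≤k = jump-other (not-multiple 0 1≤k)

module Member (k t : ℕ) = TwoClassShift k (+ t * + suc k) (∣n⇒∣m*n (+ t) ∣-refl)

shiftFamily : (k : ℕ) → ℕ → AffinePerm (suc k)
shiftFamily k t = Member.affine k t

-- For n ≥ 2 the family is injective, read off from the jump at 1.
shiftFamily-injective : ∀ k → 1 ≤ k → ∀ t u → shiftFamily k t ≈ᴬ shiftFamily k u → t ≡ u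
shiftFamily-injective k 1≤k t u σt≈σu =
  ZP.+-injective (ZP.*-cancelʳ-≡ (+ t) (+ u) (+ suc k) (ZP.neg-injective (begin
    - (+ t * + suc k)  ≡⟨ sym (T.jump-one 1≤k) ⟩
    T.jump (+ 1)       ≡⟨ ∙-cancelˡ (+ 1) (T.jump (+ 1)) (U.jump (+ 1)) (σt≈σu (+ 1)) ⟩
    U.jump (+ 1)       ≡⟨ U.jump-one 1≤k ⟩
    - (+ u * + suc k)  ∎)))
  where
  open ≡-Reasoning
  module T = Member k t
  module U = Member k u

proposition3p1 : (n : ℕ) → 2 ≤ n → (m : ℕ) → (p : Permutation′ m) →
    Contains321 p → InfinitelyMany (λ (w : AffinePerm n) → Avoids w p)
proposition3p1 (suc zero)    (s≤s ())
proposition3p1 (suc (suc k)) _ m p p∋321 =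
  shiftFamily (suc k) ,
  shiftFamily-injective (suc k) (s≤s z≤n) ,
  λ t → Member.avoids-321-patterns (suc k) t p p∋321
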